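{- Let $t,t'$ be checkers terms with $t\to t'$ by one checkers head step. (1) Quantitative subject reduction: if $\mathcal{D}$ is a derivation of $\Gamma\vdash^kt:L$, then there is a derivation $\mathcal{D}'$ of $\Gamma\vdash^{k'}t':L$ with $|\mathcal{D}'|=|\mathcal{D}|-1$; moreover, if the step is an interaction head step then $k'=k-1$, and if it is a silent head step then $k'=k$. (2) Subject expansion: if $\Gamma\vdash^{k'}t':L$ is derivable, then $\Gamma\vdash^{k}t:L$ is derivable for some $k$.
   Context: Checkers terms: $t,u ::= x\mid\lambda_cx.t\mid t\cdot^cu$, $c\in\{\circ,\bullet\}$, modulo $\alpha$. A redex $(\lambda_cx.t)\cdot^du$ contracts to $t\{x:=u\}$; silent if $c=d$, interaction if $c\ne d$. Head contexts $H ::= \lambda_{c_1}x_1\ldots\lambda_{c_n}x_n.(\cdots(\langle\cdot\rangle\cdot^{d_1}t_1)\cdots)\cdot^{d_k}t_k$; a checkers head step is $H\langle r\rangle\to H\langle r'\rangle$ for a redex $r$ contracting to $r'$, silent or interaction according to $r$. Types: linear $L ::= X\mid M\to_cL$; multi $M ::= [L_1,\ldots,L_n]$; environments $\Gamma$ (finite support), pointwise $+$, $\Gamma,x:M$ with $x\notin\mathrm{supp}(\Gamma)$. Rules: (ax) $x:[L]\vdash^0x:L$; (many) from $\Gamma_i\vdash^{k_i}t:L_i$ ($i\in I$ finite) infer $\sum\Gamma_i\vdash^{\sum k_i}t:[L_i]_{i\in I}$; ($\lambda$) from $\Gamma,x:M\vdash^kt:L$ infer $\Gamma\vdash^k\lambda_cx.t:M\to_cL$;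 (@) from $\Gamma\vdash^{k_1}t:M\to_cL$ and $\Delta\vdash^{k_2}u:M$ infer $\Gamma+\Delta\vdash^kt\cdot^du:L$, $k=k_1+k_2$ if $c=d$, else $k_1+k_2+1$. The applicative size $|\mathcal{D}|$ of a derivation $\mathcal{D}$ is the number of (@) rules in it. -}

module Defs where

open import Data.Nat using (ℕ; zero; suc; _+_)
open import Data.Fin using (Fin; zero; suc)
open import Data.List using (List; []; _∷_; _++_; foldl)
open import Data.Vec using (Vec; []; _∷_; replicate; zipWith; _[_]≔_)
open import Data.Vec.Relation.Binary.Pointwise.Inductive using (Pointwise)
open import Data.Product using (_×_; _,_)

-- Colours and checkers terms (de Bruijn indices: terms modulo α)

data Color : Set where
  ∘ ● : Color

data Term (n : ℕ) : Set where
  var : Fin n → Term n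
  lam : Color → Term (suc n) → Term n          -- λ_c x. t  (x = index 0)
  app : Term n → Color → Term n → Term n

Ren : ℕ → ℕ → Set
Ren m n = Fin m → Fin n

liftR : ∀ {m n} → Ren m n → Ren (suc m) (suc n)
liftR ρ zero    = zero
liftR ρ (suc i) = suc (ρ i)

rename : ∀ {m n} → Ren m n → Term m → Term n
rename ρ (var i)     = var (ρ i)
rename ρ (lam c t)   = lam c (rename (liftR ρ) t)
rename ρ (app t d u) = app (rename ρ t) d (rename ρ u)

Sub : ℕ → ℕ → Set
Sub m n = Fin m → Term n

liftS : ∀ {m n} → Sub m n → Sub (suc m) (suc n)
liftS σ zero    = var zero
liftS σ (suc i) = rename suc (σ i)

subst : ∀ {m n} → Sub m n → Term m → Term n
subst σ (var i)     = σ i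
subst σ (lam c t)   = lam c (subst (liftS σ) t)
subst σ (app t d u) = app (subst σ t) d (subst σ u)

-- t{x:=u} where x is the bound variable (index 0)
topSub : ∀ {n} → Term n → Sub (suc n) n
topSub u zero    = u
topSub u (suc i) = var i

_[_/0] : ∀ {n} → Term (suc n) → Term n → Term n
t [ u /0] = subst (topSub u) t

-- Head contexts  H ::= λ_{c1}x1 … λ_{cn}xn. (⋯(⟨·⟩ ·^{d1} t1)⋯) ·^{dk} tk
-- HCtx m n : context with outer scope m whose hole is in scope n

data HCtx (m : ℕ) : ℕ → Set where
  apps : List (Color × Term m) → HCtx m m
  lam  : ∀ {n} → Color → HCtx (suc m) n → HCtx m n

plug : ∀ {m n} → HCtx m n → Term n → Term m
plug (apps args) r = foldl (λ acc p → app acc (Data.Product.proj₁ p) (Data.Product.proj₂ p)) r args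
plug (lam c H)   r = lam c (plug H r)

data StepKind : Set where
  silent interaction : StepKind

kind : Color → Color → StepKind
kind ∘ ∘ = silent
kind ● ● = silent
kind ∘ ● = interaction
kind ● ∘ = interaction

data _⟶h[_]_ {m : ℕ} : Term m → StepKind → Term m → Set where
  head-step : ∀ {n} (H : HCtx m n) (c d : Color) (t : Term (suc n)) (u : Term n) →
              plug H (app (lam c t) d u) ⟶h[ kind c d ] plug H (t [ u /0])

-- Types. Multi types [L1,…,Ln] are multisets; they are represented by
-- lists and compared up to the (deep) multiset equivalence _≈M_ below.

mutual
  data LType : Set where
    tvar : ℕ → LType
    _⇒[_]_ : MType → Color → LType → LType

  MType : Set
  MType = List LType

mutual
  data _≈L_ : LType → LType → Set where
    tvar≈ : ∀ {X} → tvar X ≈L tvar X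
    ⇒≈    : ∀ {M M' c L L'} → M ≈M M' → L ≈L L' → (M ⇒[ c ] L) ≈L (M' ⇒[ c ] L')

  data _≈M_ : MType → MType → Set where
    []≈   : [] ≈M []
    prep  : ∀ {L L' M M'} → L ≈L L' → M ≈M M' → (L ∷ M) ≈M (L' ∷ M')
    swap  : ∀ {L₁ L₁' L₂ L₂' M M'} → L₁ ≈L L₁' → L₂ ≈L L₂' → M ≈M M' →
            (L₁ ∷ L₂ ∷ M) ≈M (L₂' ∷ L₁' ∷ M')
    trans : ∀ {M₁ M₂ M₃} → M₁ ≈M M₂ → M₂ ≈M M₃ → M₁ ≈M M₃

-- type environments for terms in scope n (finite support automatic)
Env : ℕ → Set
Env n = Vec MType n

∅ : ∀ {n} → Env n
∅ = replicate _ []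

_+E_ : ∀ {n} → Env n → Env n → Env n
_+E_ = zipWith _++_

_≈E_ : ∀ {n} → Env n → Env n → Set
_≈E_ = Pointwise _≈M_

single : ∀ {n} → Fin n → LType → Env n
single x L = ∅ [ x ]≔ (L ∷ [])

cost : Color → Color → ℕ
cost ∘ ∘ = 0
cost ● ● = 0
cost ∘ ● = 1
cost ● ∘ = 1

mutual
  data _⊢[_]_∶_ {n : ℕ} : Env n → ℕ → Term n → LType → Set where
    ax  : ∀ {x L} → single x L ⊢[ 0 ] var x ∶ L
    lam : ∀ {Γ k M c t L} → (M ∷ Γ) ⊢[ k ] t ∶ L → Γ ⊢[ k ] lam c t ∶ (M ⇒[ c ] L)
    app : ∀ {Γ Δ k₁ k₂ M M' c d t u L} →
          Γ ⊢[ k₁ ] t ∶ (M ⇒[ c ] L) → Δ ⊢[ k₂ ]ₘ u ∶ M' → M ≈M M' →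
          (Γ +E Δ) ⊢[ k₁ + k₂ + cost c d ] app t d u ∶ L

  -- rule (many), with the finite family given as a list
  data _⊢[_]ₘ_∶_ {n : ℕ} : Env n → ℕ → Term n → MType → Set where
    many[] : ∀ {t} → ∅ ⊢[ 0 ]ₘ t ∶ []
    many∷  : ∀ {Γ Δ k k' t L M} → Γ ⊢[ k ] t ∶ L → Δ ⊢[ k' ]ₘ t ∶ M →
             (Γ +E Δ) ⊢[ k + k' ]ₘ t ∶ (L ∷ M)

mutual
  size : ∀ {n} {Γ : Env n} {k t L} → Γ ⊢[ k ] t ∶ L → ℕ
  size ax          = 0
  size (lam D)     = size D
  size (app D E _) = suc (size D + sizeₘ E)

  sizeₘ : ∀ {n} {Γ : Env n} {k t M} → Γ ⊢[ k ]ₘ t ∶ M → ℕ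
  sizeₘ many[]       = 0
  sizeₘ (many∷ D E)  = size D + sizeₘ E

{-# OPTIONS --safe #-}
module Submission where

-- At the contracted redex (λ_c x.t) ·^d u, a derivation ends with (@) over (λ): a derivation of t
-- in which x has some multi type M, and a (many) derivation giving u one derivation per element
-- of M. Substituting these for the axioms on x uses each of them exactly once, so environments,
-- counters and applicative sizes simply add up; only the (@) rule of the redex is lost, and with
-- it the counter increment it carries iff the step is an interaction. Conversely, a derivation of
-- t{x:=u} splits along the occurrences of u into a derivation of t and a (many) derivation of u,
-- which reassemble into a derivation of the redex. Head contexts only wrap the hole in (λ) and
-- left (@) rules, so both directions extend to head steps. Substitution is handled for
-- simultaneous substitutions, which is what makes the induction go through binders.

open import Defs
open import Algebra.Bundles using (CommutativeMonoid)
import Algebra.Properties.CommutativeSemigroup as CommutativeSemigroupProperties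
open import Data.Fin using (Fin; zero; suc)
open import Data.List using (List; []; _∷_; _++_)
import Data.List.Properties as List
open import Data.List.Relation.Binary.Pointwise as Pointwiseᴸ using (Pointwise; []; _∷_; ++⁺)
open import Data.Nat using (ℕ; zero; suc; _+_; _∸_)
open import Data.Nat.Properties using (+-assoc; +-identityʳ; m+n∸n≡m; +-commutativeSemigroup)
open import Data.Product using (Σ; ∃-syntax; _×_; _,_)
open import Data.Vec using ([]; _∷_; _[_]≔_)
import Data.Vec.Properties as Vec
open import Data.Vec.Relation.Binary.Pointwise.Inductive as Pointwiseⱽ using ([]; _∷_)
open import Relation.Binary.Definitions using (Reflexive; Symmetric; Transitive)
open import Relation.Binary.PropositionalEquality as ≡ using (_≡_; refl; cong; cong₂)

private
  variable
    m n k k' s : ℕ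
    L : LType
    M M' N : MType
    Γ Δ : Env n
    t u r r' : Term n
    σ : Sub m n

-- Multiset equality of types

mutual
  ≈L-refl : Reflexive _≈L_
  ≈L-refl {tvar X}     = tvar≈
  ≈L-refl {M ⇒[ c ] L} = ⇒≈ ≈M-refl ≈L-refl

  ≈M-refl : Reflexive _≈M_
  ≈M-refl {[]}    = []≈
  ≈M-refl {L ∷ M} = prep ≈L-refl ≈M-refl

mutual
  ≈L-sym : Symmetric _≈L_
  ≈L-sym tvar≈    = tvar≈
  ≈L-sym (⇒≈ p q) = ⇒≈ (≈M-sym p) (≈L-sym q)

  ≈M-sym : Symmetric _≈M_
  ≈M-sym []≈          = []≈
  ≈M-sym (prep p q)   = prep (≈L-sym p) (≈M-sym q)
  ≈M-sym (swap p q r) = swap (≈L-sym q) (≈L-sym p) (≈M-sym r)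
  ≈M-sym (trans p q)  = trans (≈M-sym q) (≈M-sym p)

≈L-trans : Transitive _≈L_
≈L-trans tvar≈    tvar≈      = tvar≈
≈L-trans (⇒≈ p q) (⇒≈ p' q') = ⇒≈ (trans p p') (≈L-trans q q')

≈M-reflexive : M ≡ M' → M ≈M M'
≈M-reflexive refl = ≈M-refl

++-congM : ∀ {A A' B B'} → A ≈M A' → B ≈M B' → (A ++ B) ≈M (A' ++ B')
++-congM []≈           q = q
++-congM (prep p r)    q = prep p (++-congM r q)
++-congM (swap p p' r) q = swap p p' (++-congM r q)
++-congM (trans r r')  q = trans (++-congM r q) (++-congM r' ≈M-refl)

∷-++-shiftM : ∀ L A B → (L ∷ A ++ B) ≈M (A ++ L ∷ B)
∷-++-shiftM L []       B = ≈M-refl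
∷-++-shiftM L (L' ∷ A) B =
  trans (swap ≈L-refl ≈L-refl ≈M-refl) (prep ≈L-refl (∷-++-shiftM L A B))

++-commM : ∀ A B → (A ++ B) ≈M (B ++ A)
++-commM []      B = ≈M-reflexive (≡.sym (List.++-identityʳ B))
++-commM (L ∷ A) B = trans (prep ≈L-refl (++-commM A B)) (∷-++-shiftM L B A)

MType-commutativeMonoid : CommutativeMonoid _ _
MType-commutativeMonoid = record
  { _≈_ = _≈M_
  ; _∙_ = _++_
  ; ε   = []
  ; isCommutativeMonoid = record
    { isMonoid = record
      { isSemigroup = record
        { isMagma = record
          { isEquivalence = record { refl = ≈M-refl ; sym = ≈M-sym ; trans = trans }
          ; ∙-cong        = ++-congM
          }
        ; assoc = λ A B C → ≈M-reflexive (List.++-assoc A B C)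
        }
      ; identity = (λ _ → ≈M-refl) , (λ A → ≈M-reflexive (List.++-identityʳ A))
      }
    ; comm = ++-commM
    }
  }

_≋_ : MType → MType → Set
_≋_ = Pointwise _≈L_

≋-refl : M ≋ M
≋-refl = Pointwiseᴸ.refl ≈L-refl

≋⇒≈M : M ≋ M' → M ≈M M'
≋⇒≈M []       = []≈
≋⇒≈M (p ∷ ps) = prep p (≋⇒≈M ps)

≋-++⁻ : ∀ M₁ {M₂} → (M₁ ++ M₂) ≋ N →
        ∃[ N₁ ] ∃[ N₂ ] N ≡ N₁ ++ N₂ × M₁ ≋ N₁ × M₂ ≋ N₂
≋-++⁻ []       ps       = [] , _ , refl , [] , ps
≋-++⁻ (L ∷ M₁) (p ∷ ps) with ≋-++⁻ M₁ ps
... | N₁ , N₂ , refl , ps₁ , ps₂ = _ ∷ N₁ , N₂ , refl , p ∷ ps₁ , ps₂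

+E-assoc : (Γ Γ' Γ'' : Env n) → ((Γ +E Γ') +E Γ'') ≡ (Γ +E (Γ' +E Γ''))
+E-assoc = Vec.zipWith-assoc List.++-assoc

+E-identityˡ : (Γ : Env n) → (∅ +E Γ) ≡ Γ
+E-identityˡ = Vec.zipWith-identityˡ List.++-identityˡ

+E-identityʳ : (Γ : Env n) → (Γ +E ∅) ≡ Γ
+E-identityʳ = Vec.zipWith-identityʳ List.++-identityʳ

Env-commutativeMonoid : ℕ → CommutativeMonoid _ _
Env-commutativeMonoid n = record
  { Carrier = Env n
  ; _≈_ = _≈E_
  ; _∙_ = _+E_
  ; ε   = ∅
  ; isCommutativeMonoid = record
    { isMonoid = record
      { isSemigroup = record
        { isMagma = record
          { isEquivalence = Pointwiseⱽ.isEquivalence M.isEquivalence n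
          ; ∙-cong        = Pointwiseⱽ.zipWith-cong M.∙-cong
          }
        ; assoc = Pointwiseⱽ.zipWith-assoc M.assoc
        }
      ; identity = Pointwiseⱽ.zipWith-identityˡ M.identityˡ
                 , Pointwiseⱽ.zipWith-identityʳ M.identityʳ
      }
    ; comm = Pointwiseⱽ.zipWith-comm M.comm
    }
  }
  where module M = CommutativeMonoid MType-commutativeMonoid

module ≈E {n : ℕ} where
  open CommutativeMonoid (Env-commutativeMonoid n) public
    using (refl; sym; trans; reflexive; comm) renaming (∙-cong to +E-cong)
  open CommutativeSemigroupProperties (CommutativeMonoid.commutativeSemigroup (Env-commutativeMonoid n))
    public using (interchange; x∙yz≈y∙xz)

module +ℕ = CommutativeSemigroupProperties +-commutativeSemigroup

∅-≔-[] : (x : Fin n) → (∅ [ x ]≔ []) ≡ ∅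
∅-≔-[] zero    = refl
∅-≔-[] (suc x) = cong ([] ∷_) (∅-≔-[] x)

∅-≔-cong : (x : Fin n) → M ≈M M' → (∅ [ x ]≔ M) ≈E (∅ [ x ]≔ M')
∅-≔-cong zero    p = p ∷ ≈E.refl
∅-≔-cong (suc x) p = []≈ ∷ ∅-≔-cong x p

single-+E-≔ : ∀ (x : Fin n) L M → (single x L +E (∅ [ x ]≔ M)) ≡ (∅ [ x ]≔ (L ∷ M))
single-+E-≔ zero    L M = cong ((L ∷ M) ∷_) (+E-identityˡ ∅)
single-+E-≔ (suc x) L M = cong ([] ∷_) (single-+E-≔ x L M)

_⊢[_∣_]_∶_ : Env n → ℕ → ℕ → Term n → LType → Set
Γ ⊢[ k ∣ s ] t ∶ L = Σ (Γ ⊢[ k ] t ∶ L) λ D → size D ≡ s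

_⊢[_∣_]ₘ_∶_ : Env n → ℕ → ℕ → Term n → MType → Set
Γ ⊢[ k ∣ s ]ₘ t ∶ M = Σ (Γ ⊢[ k ]ₘ t ∶ M) λ E → sizeₘ E ≡ s

cast⊢ : ∀ {Γ'} → Γ ≡ Γ' → Γ ⊢[ k ∣ s ] t ∶ L → Γ' ⊢[ k ∣ s ] t ∶ L
cast⊢ refl D = D

cast⊢ₘ : ∀ {Γ' t'} → Γ ≡ Γ' → t ≡ t' → Γ ⊢[ k ∣ s ]ₘ t ∶ M → Γ' ⊢[ k ∣ s ]ₘ t' ∶ M
cast⊢ₘ refl refl E = E

-- Derivations are not closed under ≈ (the axiom fixes its type), so results are only up to ≈.
record _≈⊢[_∣_]_∶_ (Γ : Env n) (k s : ℕ) (t : Term n) (L : LType) : Set where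
  constructor ≈typed
  field
    {env}      : Env n
    {counter}   : ℕ
    {type}     : LType
    derivation : env ⊢[ counter ∣ s ] t ∶ type
    env≈       : env ≈E Γ
    counter≡    : counter ≡ k
    type≈      : type ≈L L

record _≈⊢[_∣_]ₘ_∶_ (Γ : Env n) (k s : ℕ) (t : Term n) (M : MType) : Set where
  constructor ≈typedₘ
  field
    {env}      : Env n
    {counter}   : ℕ
    {type}     : MType
    derivation : env ⊢[ counter ∣ s ]ₘ t ∶ type
    env≈       : env ≈E Γ
    counter≡    : counter ≡ k
    type≋      : type ≋ M

_≈⊢_∶_ : Env n → Term n → LType → Set
Γ ≈⊢ t ∶ L = ∃[ k ] ∃[ s ] Γ ≈⊢[ k ∣ s ] t ∶ L

data _∗_ (P Q : Env n → ℕ → ℕ → Set) (Δ : Env n) (k s : ℕ) : Set where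
  split : ∀ {Δ₁ Δ₂ k₁ k₂ s₁ s₂} → P Δ₁ k₁ s₁ → Q Δ₂ k₂ s₂ →
          Δ ≈E (Δ₁ +E Δ₂) → k ≡ k₁ + k₂ → s ≡ s₁ + s₂ → (P ∗ Q) Δ k s

⊢ₘ-var : ∀ (x : Fin n) M → (∅ [ x ]≔ M) ⊢[ 0 ∣ 0 ]ₘ var x ∶ M
⊢ₘ-var x []      = cast⊢ₘ (≡.sym (∅-≔-[] x)) refl (many[] , refl)
⊢ₘ-var x (L ∷ M) =
  let E , eq = ⊢ₘ-var x M in cast⊢ₘ (single-+E-≔ x L M) refl (many∷ ax E , eq)

⊢ₘ-var⁻ : ∀ {x : Fin n} → Δ ⊢[ k ]ₘ var x ∶ N → Δ ≡ (∅ [ x ]≔ N)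
⊢ₘ-var⁻ {x = x} many[]               = ≡.sym (∅-≔-[] x)
⊢ₘ-var⁻ {x = x} (many∷ {L = L} ax E) =
  ≡.trans (cong (single x L +E_) (⊢ₘ-var⁻ E)) (single-+E-≔ x L _)

⊢ₘ-++⁻ : ∀ N₁ {N₂} → Δ ⊢[ k ∣ s ]ₘ u ∶ (N₁ ++ N₂) →
         ((λ Δ k s → Δ ⊢[ k ∣ s ]ₘ u ∶ N₁) ∗ (λ Δ k s → Δ ⊢[ k ∣ s ]ₘ u ∶ N₂)) Δ k s
⊢ₘ-++⁻ []       E = split (many[] , refl) E (≈E.reflexive (≡.sym (+E-identityˡ _))) refl refl
⊢ₘ-++⁻ (L ∷ N₁) (many∷ {Γ = Γ} {k = k} D E , refl) with ⊢ₘ-++⁻ N₁ (E , refl)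
... | split {Δ₁} {Δ₂} {k₁} {k₂} {s₁} {s₂} (E₁ , refl) E₂ eΔ refl eq =
  split (many∷ D E₁ , refl) E₂
    (≈E.trans (≈E.+E-cong ≈E.refl eΔ) (≈E.reflexive (≡.sym (+E-assoc Γ Δ₁ Δ₂))))
    (≡.sym (+-assoc k k₁ k₂))
    (≡.trans (cong (size D +_) eq) (≡.sym (+-assoc (size D) s₁ s₂)))

⊢ₘ-++⁺ : ∀ {Γ N₁ N₂} → Γ ⊢[ k ]ₘ u ∶ N₁ → Δ ⊢[ k' ]ₘ u ∶ N₂ →
         ∃[ k'' ] (Γ +E Δ) ⊢[ k'' ]ₘ u ∶ (N₁ ++ N₂)
⊢ₘ-++⁺ {Δ = Δ} many[] E' =
  _ , ≡.subst (λ Δ' → Δ' ⊢[ _ ]ₘ _ ∶ _) (≡.sym (+E-identityˡ Δ)) E'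
⊢ₘ-++⁺ {Δ = Δ} (many∷ {Γ = Γ₁} {Γ₂} {k} D E) E' =
  let k' , E'' = ⊢ₘ-++⁺ E E'
  in k + k' , ≡.subst (λ Δ' → Δ' ⊢[ k + k' ]ₘ _ ∶ _) (≡.sym (+E-assoc Γ₁ Γ₂ Δ)) (many∷ D E'')

permuteₘ : M ≈M M' → N ≋ M' → (E : Δ ⊢[ k ]ₘ u ∶ N) → Δ ≈⊢[ k ∣ sizeₘ E ]ₘ u ∶ M
permuteₘ []≈ [] many[] = ≈typedₘ (many[] , refl) ≈E.refl refl []
permuteₘ (prep p ps) (q ∷ qs) (many∷ {k = k} D E) with permuteₘ ps qs E
... | ≈typedₘ (E' , eq) eΔ eq' qs' =
  ≈typedₘ (many∷ D E' , cong (size D +_) eq) (≈E.+E-cong ≈E.refl eΔ) (cong (k +_) eq')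
          (≈L-trans q (≈L-sym p) ∷ qs')
permuteₘ (swap p₁ p₂ ps) (q₂ ∷ q₁ ∷ qs)
         (many∷ {Γ = Γ₂} {k = k₂} D₂ (many∷ {Γ = Γ₁} {k = k₁} D₁ E))
  with permuteₘ ps qs E
... | ≈typedₘ {env = Δ} {counter = k} (E' , eq) eΔ refl qs' =
  ≈typedₘ (many∷ D₁ (many∷ D₂ E') , size≡)
          (≈E.trans (≈E.x∙yz≈y∙xz Γ₁ Γ₂ Δ) (≈E.+E-cong ≈E.refl (≈E.+E-cong ≈E.refl eΔ)))
          (+ℕ.x∙yz≈y∙xz k₁ k₂ k)
          (≈L-trans q₁ (≈L-sym p₁) ∷ ≈L-trans q₂ (≈L-sym p₂) ∷ qs')
  where
  size≡ : size D₁ + (size D₂ + sizeₘ E') ≡ size D₂ + (size D₁ + sizeₘ E)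
  size≡ = ≡.trans (+ℕ.x∙yz≈y∙xz (size D₁) (size D₂) (sizeₘ E'))
                  (cong (λ s → size D₂ + (size D₁ + s)) eq)
permuteₘ (trans ps ps') qs E with permuteₘ ps' qs E
... | ≈typedₘ (E₁ , eq₁) eΔ₁ eq₁' qs₁ with permuteₘ ps qs₁ E₁
... | ≈typedₘ (E₂ , eq₂) eΔ₂ eq₂' qs₂ =
  ≈typedₘ (E₂ , ≡.trans eq₂ eq₁) (≈E.trans eΔ₂ eΔ₁) (≡.trans eq₂' eq₁') qs₂

-- Renaming along order-preserving embeddings

data OPE : ℕ → ℕ → Set where
  done : OPE 0 0
  keep : OPE m n → OPE (suc m) (suc n)
  skip : OPE m n → OPE m (suc n)

⟦_⟧ : OPE m n → Ren m n
⟦ keep θ ⟧ = liftR ⟦ θ ⟧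
⟦ skip θ ⟧ i = suc (⟦ θ ⟧ i)

idOPE : OPE n n
idOPE {zero}  = done
idOPE {suc n} = keep idOPE

⟦idOPE⟧ : (i : Fin n) → ⟦ idOPE ⟧ i ≡ i
⟦idOPE⟧ zero    = refl
⟦idOPE⟧ (suc i) = cong suc (⟦idOPE⟧ i)

_*E_ : OPE m n → Env m → Env n
done   *E []      = []
keep θ *E (M ∷ Γ) = M ∷ (θ *E Γ)
skip θ *E Γ       = [] ∷ (θ *E Γ)

idOPE-*E : (Γ : Env n) → (idOPE *E Γ) ≡ Γ
idOPE-*E []      = refl
idOPE-*E (M ∷ Γ) = cong (M ∷_) (idOPE-*E Γ)

*E-∅ : (θ : OPE m n) → (θ *E ∅) ≡ ∅
*E-∅ done     = refl
*E-∅ (keep θ) = cong ([] ∷_) (*E-∅ θ)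
*E-∅ (skip θ) = cong ([] ∷_) (*E-∅ θ)

*E-+E : (θ : OPE m n) (Γ Γ' : Env m) → (θ *E (Γ +E Γ')) ≡ ((θ *E Γ) +E (θ *E Γ'))
*E-+E done     []      []       = refl
*E-+E (keep θ) (M ∷ Γ) (M' ∷ Γ') = cong ((M ++ M') ∷_) (*E-+E θ Γ Γ')
*E-+E (skip θ) Γ       Γ'       = cong ([] ∷_) (*E-+E θ Γ Γ')

*E-single : ∀ (θ : OPE m n) (x : Fin m) L → (θ *E single x L) ≡ single (⟦ θ ⟧ x) L
*E-single (keep θ) zero    L = cong ((L ∷ []) ∷_) (*E-∅ θ)
*E-single (keep θ) (suc x) L = cong ([] ∷_) (*E-single θ x L)
*E-single (skip θ) x       L = cong ([] ∷_) (*E-single θ x L)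

mutual
  rename⁺ : (θ : OPE m n) (D : Γ ⊢[ k ] t ∶ L) →
            (θ *E Γ) ⊢[ k ∣ size D ] rename ⟦ θ ⟧ t ∶ L
  rename⁺ θ (ax {x} {L}) = cast⊢ (≡.sym (*E-single θ x L)) (ax , refl)
  rename⁺ θ (lam D)      = let D' , eq = rename⁺ (keep θ) D in lam D' , eq
  rename⁺ θ (app {Γ = Γ} {Δ} D E q) =
    let D' , eq = rename⁺ θ D ; E' , eq' = rename⁺ₘ θ E
    in cast⊢ (≡.sym (*E-+E θ Γ Δ)) (app D' E' q , cong suc (cong₂ _+_ eq eq'))

  rename⁺ₘ : (θ : OPE m n) (E : Γ ⊢[ k ]ₘ t ∶ M) →
             (θ *E Γ) ⊢[ k ∣ sizeₘ E ]ₘ rename ⟦ θ ⟧ t ∶ M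
  rename⁺ₘ θ many[] = cast⊢ₘ (≡.sym (*E-∅ θ)) refl (many[] , refl)
  rename⁺ₘ θ (many∷ {Γ = Γ} {Δ} D E) =
    let D' , eq = rename⁺ θ D ; E' , eq' = rename⁺ₘ θ E
    in cast⊢ₘ (≡.sym (*E-+E θ Γ Δ)) refl (many∷ D' E' , cong₂ _+_ eq eq')

mutual
  rename⁻ : (θ : OPE m n) (t : Term m) → Γ ⊢[ k ] rename ⟦ θ ⟧ t ∶ L →
            ∃[ Γ' ] Γ ≡ θ *E Γ' × Γ' ⊢[ k ] t ∶ L
  rename⁻ {L = L} θ (var x) ax = single x L , ≡.sym (*E-single θ x L) , ax
  rename⁻ θ (lam c t) (lam D) with rename⁻ (keep θ) t D
  ... | M ∷ Γ' , refl , D' = Γ' , refl , lam D'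
  rename⁻ θ (app t d u) (app D E q) with rename⁻ θ t D | rename⁻ₘ θ u E
  ... | Γ₁ , refl , D' | Γ₂ , refl , E' = Γ₁ +E Γ₂ , ≡.sym (*E-+E θ Γ₁ Γ₂) , app D' E' q

  rename⁻ₘ : (θ : OPE m n) (t : Term m) → Γ ⊢[ k ]ₘ rename ⟦ θ ⟧ t ∶ M →
             ∃[ Γ' ] Γ ≡ θ *E Γ' × Γ' ⊢[ k ]ₘ t ∶ M
  rename⁻ₘ θ t many[] = ∅ , ≡.sym (*E-∅ θ) , many[]
  rename⁻ₘ θ t (many∷ D E) with rename⁻ θ t D | rename⁻ₘ θ t E
  ... | Γ₁ , refl , D' | Γ₂ , refl , E' = Γ₁ +E Γ₂ , ≡.sym (*E-+E θ Γ₁ Γ₂) , many∷ D' E'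

rename-cong : ∀ {ρ ρ' : Ren m n} → (∀ i → ρ i ≡ ρ' i) → ∀ t → rename ρ t ≡ rename ρ' t
rename-cong eq (var i)     = cong var (eq i)
rename-cong eq (lam c t)   = cong (lam c) (rename-cong liftR-eq t)
  where
  liftR-eq : ∀ i → liftR _ i ≡ liftR _ i
  liftR-eq zero    = refl
  liftR-eq (suc i) = cong suc (eq i)
rename-cong eq (app t d u) = cong₂ (λ t u → app t d u) (rename-cong eq t) (rename-cong eq u)

rename-suc : (u : Term n) → rename suc u ≡ rename ⟦ skip idOPE ⟧ u
rename-suc = rename-cong (λ i → cong suc (≡.sym (⟦idOPE⟧ i)))

weaken⁺ₘ : Δ ⊢[ k ∣ s ]ₘ u ∶ M → ([] ∷ Δ) ⊢[ k ∣ s ]ₘ rename suc u ∶ M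
weaken⁺ₘ {Δ = Δ} {u = u} (E , refl) =
  cast⊢ₘ (cong ([] ∷_) (idOPE-*E Δ)) (≡.sym (rename-suc u)) (rename⁺ₘ (skip idOPE) E)

weaken⁻ₘ : ∀ {Δ : Env (suc n)} → Δ ⊢[ k ]ₘ rename suc u ∶ M →
           ∃[ Δ' ] Δ ≡ [] ∷ Δ' × Δ' ⊢[ k ]ₘ u ∶ M
weaken⁻ₘ {u = u} E
  with rename⁻ₘ (skip idOPE) u (≡.subst (λ u' → _ ⊢[ _ ]ₘ u' ∶ _) (rename-suc u) E)
... | Δ' , refl , E' = Δ' , cong ([] ∷_) (idOPE-*E Δ') , E'

-- Types are matched pointwise (≋), not up to permutation, so that
-- the typing splits along Γ₁ +E Γ₂ (⊢ˢ-+E⁻); permuteₘ brings a (many) derivation into this form.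
data _⊢ˢ[_∣_]_∶_ {n} : Env n → ℕ → ℕ → Sub m n → Env m → Set where
  nil  : ∀ {σ : Sub 0 n} → ∅ ⊢ˢ[ 0 ∣ 0 ] σ ∶ []
  cons : ∀ {σ : Sub (suc m) n} {Δ₁ Δ₂ k₁ k₂ s₁ s₂ M M' Γ} →
         Δ₁ ⊢[ k₁ ∣ s₁ ]ₘ σ zero ∶ M' → M ≋ M' → Δ₂ ⊢ˢ[ k₂ ∣ s₂ ] (λ i → σ (suc i)) ∶ Γ →
         (Δ₁ +E Δ₂) ⊢ˢ[ k₁ + k₂ ∣ s₁ + s₂ ] σ ∶ (M ∷ Γ)

_⊢ˢ_∶_ : Env n → Sub m n → Env m → Set
Δ ⊢ˢ σ ∶ Γ = ∃[ k ] ∃[ s ] Δ ⊢ˢ[ k ∣ s ] σ ∶ Γ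

cast⊢ˢ : ∀ {Δ'} → Δ ≡ Δ' → Δ ⊢ˢ[ k ∣ s ] σ ∶ Γ → Δ' ⊢ˢ[ k ∣ s ] σ ∶ Γ
cast⊢ˢ refl S = S

⊢ˢ-∅⁻ : {σ : Sub m n} → Δ ⊢ˢ[ k ∣ s ] σ ∶ ∅ → Δ ≡ ∅ × k ≡ 0 × s ≡ 0
⊢ˢ-∅⁻ {m = zero}  nil = refl , refl , refl
⊢ˢ-∅⁻ {m = suc m} (cons (many[] , refl) [] S) with ⊢ˢ-∅⁻ S
... | refl , refl , refl = +E-identityˡ ∅ , refl , refl

⊢ˢ-∅ : {σ : Sub m n} → ∅ ⊢ˢ[ 0 ∣ 0 ] σ ∶ ∅
⊢ˢ-∅ {m = zero}  = nil
⊢ˢ-∅ {m = suc m} = cast⊢ˢ (+E-identityˡ ∅) (cons (many[] , refl) [] ⊢ˢ-∅)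

⊢ˢ-lookup : (x : Fin m) → Δ ⊢ˢ[ k ∣ s ] σ ∶ single x L → Δ ≈⊢[ k ∣ s ] σ x ∶ L
⊢ˢ-lookup zero (cons (many∷ D many[] , refl) (p ∷ []) S) with ⊢ˢ-∅⁻ S
... | refl , refl , refl =
  ≈typed (D , ≡.sym (+0+0 (size D)))
         (≈E.reflexive (≡.sym (≡.trans (+E-identityʳ _) (+E-identityʳ _))))
         (≡.sym (+0+0 _)) (≈L-sym p)
  where
  +0+0 : ∀ a → a + 0 + 0 ≡ a
  +0+0 a = ≡.trans (+-identityʳ (a + 0)) (+-identityʳ a)
⊢ˢ-lookup (suc x) (cons (many[] , refl) [] S) with ⊢ˢ-lookup x S
... | ≈typed D eΔ eq eL =
  ≈typed D (≈E.trans eΔ (≈E.reflexive (≡.sym (+E-identityˡ _)))) eq eL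

⊢ˢ-+E⁻ : (Γ₁ Γ₂ : Env m) → Δ ⊢ˢ[ k ∣ s ] σ ∶ (Γ₁ +E Γ₂) →
         ((λ Δ k s → Δ ⊢ˢ[ k ∣ s ] σ ∶ Γ₁) ∗ (λ Δ k s → Δ ⊢ˢ[ k ∣ s ] σ ∶ Γ₂)) Δ k s
⊢ˢ-+E⁻ [] [] nil = split nil nil (≈E.reflexive (≡.sym (+E-identityˡ ∅))) refl refl
⊢ˢ-+E⁻ (M₁ ∷ Γ₁) (M₂ ∷ Γ₂) (cons E p S) with ≋-++⁻ M₁ p | ⊢ˢ-+E⁻ Γ₁ Γ₂ S
... | N₁ , N₂ , refl , p₁ , p₂ | split {Δ₁} {Δ₂} {k₁} {k₂} {s₁} {s₂} S₁ S₂ eΔ refl refl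
  with ⊢ₘ-++⁻ N₁ E
... | split {Δ₁'} {Δ₂'} {k₁'} {k₂'} {s₁'} {s₂'} E₁ E₂ eΔ' refl refl =
  split (cons E₁ p₁ S₁) (cons E₂ p₂ S₂)
    (≈E.trans (≈E.+E-cong eΔ' eΔ) (≈E.interchange Δ₁' Δ₂' Δ₁ Δ₂))
    (+ℕ.interchange k₁' k₂' k₁ k₂) (+ℕ.interchange s₁' s₂' s₁ s₂)

⊢ˢ-+E⁺ : ∀ {Γ₁ Γ₂ Δ₁ Δ₂} → Δ₁ ⊢ˢ σ ∶ Γ₁ → Δ₂ ⊢ˢ σ ∶ Γ₂ →
         ∃[ Δ ] Δ ≈E (Δ₁ +E Δ₂) × Δ ⊢ˢ σ ∶ (Γ₁ +E Γ₂)
⊢ˢ-+E⁺ (_ , _ , nil) (_ , _ , nil) = ∅ , ≈E.reflexive (≡.sym (+E-identityˡ ∅)) , _ , _ , nil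
⊢ˢ-+E⁺ (_ , _ , cons {Δ₁ = Δ₁} {Δ₂} (E₁ , _) p₁ S₁)
       (_ , _ , cons {Δ₁ = Δ₁'} {Δ₂'} (E₂ , _) p₂ S₂)
  with ⊢ˢ-+E⁺ (_ , _ , S₁) (_ , _ , S₂) | ⊢ₘ-++⁺ E₁ E₂
... | _ , eΔ , _ , _ , S | _ , E =
  _ , ≈E.trans (≈E.+E-cong ≈E.refl eΔ) (≈E.interchange Δ₁ Δ₁' Δ₂ Δ₂') ,
  _ , _ , cons (E , refl) (++⁺ p₁ p₂) S

⊢ˢ-weaken : Δ ⊢ˢ[ k ∣ s ] σ ∶ Γ → ([] ∷ Δ) ⊢ˢ[ k ∣ s ] (λ i → rename suc (σ i)) ∶ Γ
⊢ˢ-weaken nil          = nil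
⊢ˢ-weaken (cons E p S) = cons (weaken⁺ₘ E) p (⊢ˢ-weaken S)

⊢ˢ-weaken⁻ : Δ ⊢ˢ[ k ∣ s ] (λ i → rename suc (σ i)) ∶ Γ →
             ∃[ Δ' ] Δ ≡ [] ∷ Δ' × Δ' ⊢ˢ σ ∶ Γ
⊢ˢ-weaken⁻ nil = ∅ , refl , _ , _ , nil
⊢ˢ-weaken⁻ {σ = σ} (cons (E , _) p S)
  with weaken⁻ₘ E | ⊢ˢ-weaken⁻ {σ = λ i → σ (suc i)} S
... | Δ₁ , refl , E' | Δ₂ , refl , _ , _ , S' = Δ₁ +E Δ₂ , refl , _ , _ , cons (E' , refl) p S'

⊢ˢ-lift : (M : MType) → Δ ⊢ˢ[ k ∣ s ] σ ∶ Γ → (M ∷ Δ) ⊢ˢ[ k ∣ s ] liftS σ ∶ (M ∷ Γ)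
⊢ˢ-lift {Δ = Δ} M S =
  cast⊢ˢ (cong₂ _∷_ (List.++-identityʳ M) (+E-identityˡ Δ))
         (cons (⊢ₘ-var zero M) ≋-refl (⊢ˢ-weaken S))

⊢ˢ-id : (Γ : Env n) → Γ ⊢ˢ[ 0 ∣ 0 ] (λ i → var i) ∶ Γ
⊢ˢ-id []      = nil
⊢ˢ-id (M ∷ Γ) =
  cast⊢ˢ (cong₂ _∷_ (List.++-identityʳ M) (+E-identityˡ Γ))
         (cons (⊢ₘ-var zero M) ≋-refl (⊢ˢ-weaken (⊢ˢ-id Γ)))

push : Ren m n → Env m → Env n
push ρ []      = ∅
push ρ (M ∷ Γ) = (∅ [ ρ zero ]≔ M) +E push (λ i → ρ (suc i)) Γ

push-suc : (ρ : Ren m n) (Γ : Env m) → push (λ i → suc (ρ i)) Γ ≡ [] ∷ push ρ Γ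
push-suc ρ []      = refl
push-suc ρ (M ∷ Γ) = cong (([] ∷ (∅ [ ρ zero ]≔ M)) +E_) (push-suc (λ i → ρ (suc i)) Γ)

push-id : (Γ : Env n) → push (λ i → i) Γ ≡ Γ
push-id []      = refl
push-id (M ∷ Γ) = ≡.trans (cong ((M ∷ ∅) +E_) (push-suc (λ i → i) Γ))
                          (cong₂ _∷_ (List.++-identityʳ M) (≡.trans (+E-identityˡ _) (push-id Γ)))

⊢ˢ-renaming⁻ : (ρ : Ren m n) → Δ ⊢ˢ[ k ∣ s ] (λ i → var (ρ i)) ∶ Γ → Δ ≈E push ρ Γ
⊢ˢ-renaming⁻ ρ nil = ≈E.refl
⊢ˢ-renaming⁻ ρ (cons (E , _) p S) =
  ≈E.+E-cong (≈E.trans (≈E.reflexive (⊢ₘ-var⁻ E)) (∅-≔-cong (ρ zero) (≈M-sym (≋⇒≈M p))))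
             (⊢ˢ-renaming⁻ (λ i → ρ (suc i)) S)

⊢ˢ-id⁻ : Δ ⊢ˢ[ k ∣ s ] (λ i → var i) ∶ Γ → Δ ≈E Γ
⊢ˢ-id⁻ {Γ = Γ} S = ≈E.trans (⊢ˢ-renaming⁻ (λ i → i) S) (≈E.reflexive (push-id Γ))

⊢ˢ-single : (x : Fin m) → Γ ⊢[ k ] σ x ∶ L → ∃[ Δ ] Δ ≈E Γ × Δ ⊢ˢ σ ∶ single x L
⊢ˢ-single zero D =
  _ , ≈E.reflexive (≡.trans (+E-identityʳ _) (+E-identityʳ _)) ,
  _ , _ , cons (many∷ D many[] , refl) ≋-refl ⊢ˢ-∅
⊢ˢ-single {σ = σ} (suc x) D with ⊢ˢ-single {σ = λ i → σ (suc i)} x D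
... | Δ , eΔ , _ , _ , S =
  _ , ≈E.trans (≈E.reflexive (+E-identityˡ Δ)) eΔ , _ , _ , cons (many[] , refl) [] S

-- Substitution and anti-substitution

mutual
  subst⁺ : (D : Γ ⊢[ k ] t ∶ L) → Δ ⊢ˢ[ k' ∣ s ] σ ∶ Γ →
           Δ ≈⊢[ k + k' ∣ size D + s ] subst σ t ∶ L
  subst⁺ (ax {x}) S = ⊢ˢ-lookup x S
  subst⁺ (lam {M = M} D) S with subst⁺ D (⊢ˢ-lift M S)
  ... | ≈typed (D' , eq) (p ∷ ps) eq' eL = ≈typed (lam D' , eq) ps eq' (⇒≈ p eL)
  subst⁺ (app {Γ = Γ₁} {Γ₂} {k₁} {k₂} {c = c} {d} D E q) S with ⊢ˢ-+E⁻ Γ₁ Γ₂ S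
  ... | split {k₁ = k₁'} {k₂'} {s₁} {s₂} S₁ S₂ eΔ refl refl with subst⁺ D S₁ | subst⁺ₘ E S₂
  ... | ≈typed (D' , eq₁) eΔ₁ refl (⇒≈ pM pL) | ≈typedₘ (E' , eq₂) eΔ₂ refl pN =
    ≈typed (app D' E' (trans pM (trans q (≈M-sym (≋⇒≈M pN)))) , size≡)
           (≈E.trans (≈E.+E-cong eΔ₁ eΔ₂) (≈E.sym eΔ)) counter≡ pL
    where
    size≡ : suc (size D' + sizeₘ E') ≡ suc (size D + sizeₘ E) + (s₁ + s₂)
    size≡ = cong suc (≡.trans (cong₂ _+_ eq₁ eq₂) (+ℕ.interchange (size D) s₁ (sizeₘ E) s₂))
    counter≡ : (k₁ + k₁') + (k₂ + k₂') + cost c d ≡ (k₁ + k₂ + cost c d) + (k₁' + k₂')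
    counter≡ = ≡.trans (cong (_+ cost c d) (+ℕ.interchange k₁ k₁' k₂ k₂'))
                      (+ℕ.xy∙z≈xz∙y (k₁ + k₂) (k₁' + k₂') (cost c d))

  subst⁺ₘ : (E : Γ ⊢[ k ]ₘ t ∶ M) → Δ ⊢ˢ[ k' ∣ s ] σ ∶ Γ →
            Δ ≈⊢[ k + k' ∣ sizeₘ E + s ]ₘ subst σ t ∶ M
  subst⁺ₘ many[] S with ⊢ˢ-∅⁻ S
  ... | refl , refl , refl = ≈typedₘ (many[] , refl) ≈E.refl refl []
  subst⁺ₘ (many∷ {Γ = Γ₁} {Γ₂} {k₁} {k₂} D E) S with ⊢ˢ-+E⁻ Γ₁ Γ₂ S
  ... | split {k₁ = k₁'} {k₂'} {s₁} {s₂} S₁ S₂ eΔ refl refl with subst⁺ D S₁ | subst⁺ₘ E S₂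
  ... | ≈typed (D' , eq₁) eΔ₁ refl pL | ≈typedₘ (E' , eq₂) eΔ₂ refl pN =
    ≈typedₘ (many∷ D' E' , ≡.trans (cong₂ _+_ eq₁ eq₂) (+ℕ.interchange (size D) s₁ (sizeₘ E) s₂))
            (≈E.trans (≈E.+E-cong eΔ₁ eΔ₂) (≈E.sym eΔ))
            (+ℕ.interchange k₁ k₁' k₂ k₂') (pL ∷ pN)

data Unsubst (σ : Sub m n) (t : Term m) (Δ : Env n) (L : LType) : Set where
  unsubst : ∀ {Γ Δ' k L'} → Γ ⊢[ k ] t ∶ L' → Δ' ⊢ˢ σ ∶ Γ → Δ' ≈E Δ → L' ≈L L →
            Unsubst σ t Δ L

data Unsubstₘ (σ : Sub m n) (t : Term m) (Δ : Env n) (M : MType) : Set where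
  unsubstₘ : ∀ {Γ Δ' k M'} → Γ ⊢[ k ]ₘ t ∶ M' → Δ' ⊢ˢ σ ∶ Γ → Δ' ≈E Δ → M' ≋ M →
             Unsubstₘ σ t Δ M

mutual
  subst⁻ : (t : Term m) → Δ ⊢[ k ] subst σ t ∶ L → Unsubst σ t Δ L
  subst⁻ {σ = σ} (var x) D with ⊢ˢ-single {σ = σ} x D
  ... | _ , eΔ , S = unsubst ax S eΔ ≈L-refl
  subst⁻ {σ = σ} (lam c t) (lam D) with subst⁻ {σ = liftS σ} t D
  ... | unsubst D₀ (_ , _ , cons (E , _) p S) eΔ eL with ⊢ₘ-var⁻ E | ⊢ˢ-weaken⁻ {σ = σ} S
  ... | refl | Δ , refl , S' =
    unsubst (lam D₀) S'
      (≈E.trans (≈E.reflexive (≡.sym (+E-identityˡ Δ))) (Pointwiseⱽ.tail eΔ))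
      (⇒≈ (trans (≋⇒≈M p) (trans (≈M-reflexive (≡.sym (List.++-identityʳ _))) (Pointwiseⱽ.head eΔ)))
          eL)
  subst⁻ {σ = σ} (app t d u) (app D E q) with subst⁻ {σ = σ} t D | subst⁻ₘ {σ = σ} u E
  ... | unsubst D₀ S₁ eΔ₁ (⇒≈ pM pL) | unsubstₘ E₀ S₂ eΔ₂ pN with ⊢ˢ-+E⁺ S₁ S₂
  ... | _ , eΔ , S =
    unsubst (app D₀ E₀ (trans pM (trans q (≈M-sym (≋⇒≈M pN))))) S
            (≈E.trans eΔ (≈E.+E-cong eΔ₁ eΔ₂)) pL

  subst⁻ₘ : (t : Term m) → Δ ⊢[ k ]ₘ subst σ t ∶ M → Unsubstₘ σ t Δ M
  subst⁻ₘ t many[] = unsubstₘ many[] (_ , _ , ⊢ˢ-∅) ≈E.refl []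
  subst⁻ₘ {σ = σ} t (many∷ D E) with subst⁻ {σ = σ} t D | subst⁻ₘ {σ = σ} t E
  ... | unsubst D₀ S₁ eΔ₁ pL | unsubstₘ E₀ S₂ eΔ₂ pN with ⊢ˢ-+E⁺ S₁ S₂
  ... | _ , eΔ , S = unsubstₘ (many∷ D₀ E₀) S (≈E.trans eΔ (≈E.+E-cong eΔ₁ eΔ₂)) (pL ∷ pN)

-- Head steps

stepCost : StepKind → ℕ
stepCost silent      = 0
stepCost interaction = 1

cost≡stepCost-kind : ∀ c d → cost c d ≡ stepCost (kind c d)
cost≡stepCost-kind ∘ ∘ = refl
cost≡stepCost-kind ∘ ● = refl
cost≡stepCost-kind ● ∘ = refl
cost≡stepCost-kind ● ● = refl

-- size D ≡ suc n, unlike the truncated size D ∸ 1, is stable under wrapping D in (@).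
SubjectReduction : StepKind → Term m → Term m → Set
SubjectReduction s t t' = ∀ {Γ k L} (D : Γ ⊢[ k ] t ∶ L) →
  ∃[ k' ] ∃[ n ] k ≡ k' + stepCost s × size D ≡ suc n × Γ ≈⊢[ k' ∣ n ] t' ∶ L

SubjectExpansion : Term m → Term m → Set
SubjectExpansion t t' = ∀ {Γ k L} → Γ ⊢[ k ] t' ∶ L → Γ ≈⊢ t ∶ L

β-reduction : ∀ c d (t : Term (suc n)) u →
              SubjectReduction (kind c d) (app (lam c t) d u) (t [ u /0])
β-reduction c d t u (app {Γ = Γ₁} {Γ₂} {k₁} {k₂} (lam D) E q) with permuteₘ q ≋-refl E
... | ≈typedₘ E' eΔ refl pM
  with subst⁺ D (cons E' (Pointwiseᴸ.symmetric ≈L-sym pM) (⊢ˢ-id Γ₁))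
... | ≈typed (D' , eq) eΔ' refl eL =
  k₁ + k₂ , size D + sizeₘ E , cong (k₁ + k₂ +_) (cost≡stepCost-kind c d) , refl ,
  ≈typed (D' , ≡.trans eq (cong (size D +_) (+-identityʳ (sizeₘ E))))
         (≈E.trans eΔ' (≈E.trans (≈E.+E-cong eΔ ≈E.refl) (≈E.comm Γ₂ Γ₁)))
         (cong (k₁ +_) (+-identityʳ k₂)) eL

β-expansion : ∀ c d (t : Term (suc n)) u →
              SubjectExpansion (app (lam c t) d u) (t [ u /0])
β-expansion c d t u D with subst⁻ t D
... | unsubst {Γ = M ∷ Γ} D₀ (_ , _ , cons {Δ₁ = Δ₁} (E , _) p S) eΔ eL =
  _ , _ , ≈typed (app (lam D₀) E (≋⇒≈M p) , refl)
                 (≈E.trans (≈E.comm Γ Δ₁) (≈E.trans (≈E.+E-cong ≈E.refl (≈E.sym (⊢ˢ-id⁻ S))) eΔ))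
                 refl eL

lam-reduction : ∀ {s} c → SubjectReduction s r r' → SubjectReduction s (lam c r) (lam c r')
lam-reduction c red (lam D) with red D
... | k' , n , eqk , eqs , ≈typed (D' , eq) (p ∷ ps) eq' eL =
  k' , n , eqk , eqs , ≈typed (lam D' , eq) ps eq' (⇒≈ p eL)

app-reduction : ∀ {s} d u → SubjectReduction s r r' → SubjectReduction s (app r d u) (app r' d u)
app-reduction {s = s} d u red (app {k₁ = k} {k₂} {c = c} D E q) with red D
... | k' , n , eqk , eqs , ≈typed (D' , eq) eΔ eq' (⇒≈ pM pL) =
  k' + k₂ + cost c d , suc (n + sizeₘ E) , counter≡ , cong (λ x → suc (x + sizeₘ E)) eqs ,
  ≈typed (app D' E (trans pM q) , cong (λ x → suc (x + sizeₘ E)) eq)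
         (≈E.+E-cong eΔ ≈E.refl) (cong (λ x → x + k₂ + cost c d) eq') pL
  where
  counter≡ : k + k₂ + cost c d ≡ (k' + k₂ + cost c d) + stepCost s
  counter≡ = ≡.trans (cong (λ x → x + k₂ + cost c d) eqk)
               (≡.trans (cong (_+ cost c d) (+ℕ.xy∙z≈xz∙y k' (stepCost s) k₂))
                        (+ℕ.xy∙z≈xz∙y (k' + k₂) (stepCost s) (cost c d)))

lam-expansion : ∀ c → SubjectExpansion r r' → SubjectExpansion (lam c r) (lam c r')
lam-expansion c exp (lam D) with exp D
... | k , n , ≈typed (D' , eq) (p ∷ ps) eq' eL = k , n , ≈typed (lam D' , eq) ps eq' (⇒≈ p eL)

app-expansion : ∀ d u → SubjectExpansion r r' → SubjectExpansion (app r d u) (app r' d u)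
app-expansion d u exp (app D E q) with exp D
... | _ , _ , ≈typed (D' , _) eΔ _ (⇒≈ pM pL) =
  _ , _ , ≈typed (app D' E (trans pM q) , refl) (≈E.+E-cong eΔ ≈E.refl) refl pL

plug-cong : (R : ∀ {m} → Term m → Term m → Set) →
            (∀ {m} {r r' : Term (suc m)} c → R r r' → R (lam c r) (lam c r')) →
            (∀ {m} {r r' : Term m} d u → R r r' → R (app r d u) (app r' d u)) →
            ∀ (H : HCtx m n) {r r'} → R r r' → R (plug H r) (plug H r')
plug-cong R R-lam R-app (apps args) = apps-cong args
  where
  apps-cong : ∀ {m} (args : List (Color × Term m)) {r r'} →
              R r r' → R (plug (apps args) r) (plug (apps args) r')
  apps-cong []               rr = rr
  apps-cong ((d , u) ∷ args) rr = apps-cong args (R-app d u rr)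
plug-cong R R-lam R-app (lam c H) rr = R-lam c (plug-cong R R-lam R-app H rr)

counter-drop : ∀ s {k k'} → k ≡ k' + stepCost s →
               (s ≡ interaction → k' ≡ k ∸ 1) × (s ≡ silent → k' ≡ k)
counter-drop silent      refl = (λ ()) , λ _ → ≡.sym (+-identityʳ _)
counter-drop interaction refl = (λ _ → ≡.sym (m+n∸n≡m _ 1)) , λ ()

proposition1 : ∀ {m} {t t' : Term m} {s : StepKind} → t ⟶h[ s ] t' →
    ((∀ {Γ k L} (D : Γ ⊢[ k ] t ∶ L) →
        Σ (Env m) λ Γ' → Σ LType λ L' → Σ ℕ λ k' → Σ (Γ' ⊢[ k' ] t' ∶ L') λ D' →
          Γ' ≈E Γ × L' ≈L L × size D' ≡ size D ∸ 1 ×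
          (s ≡ interaction → k' ≡ k ∸ 1) × (s ≡ silent → k' ≡ k))
    × (∀ {Γ k' L} → Γ ⊢[ k' ] t' ∶ L →
        Σ (Env m) λ Γ'' → Σ LType λ L'' → Σ ℕ λ k →
          Γ'' ≈E Γ × L'' ≈L L × (Γ'' ⊢[ k ] t ∶ L'')))
proposition1 (head-step H c d t u) =
  (λ D → let _ , _ , eqk , eqs , ≈typed (D' , eq) eΔ eqw eL = reduce D in
         _ , _ , _ , D' , eΔ , eL , ≡.trans eq (cong (_∸ 1) (≡.sym eqs)) ,
         counter-drop (kind c d) (≡.trans eqk (cong (_+ stepCost (kind c d)) (≡.sym eqw)))) ,
  (λ D → let _ , _ , ≈typed (D' , _) eΔ _ eL = expand D in _ , _ , _ , eΔ , eL , D')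
  where
  reduce : SubjectReduction (kind c d) (plug H (app (lam c t) d u)) (plug H (t [ u /0]))
  reduce = plug-cong (SubjectReduction _) lam-reduction app-reduction H (β-reduction c d t u)
  expand : SubjectExpansion (plug H (app (lam c t) d u)) (plug H (t [ u /0]))
  expand = plug-cong SubjectExpansion lam-expansion app-expansion H (β-expansion c d t u)
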